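{- For every integer $k\geq2$, the numbers $C_{2^1-1}, C_{2^2-1}, \ldots, C_{2^{k-1}-1}$ are pairwise distinct modulo $2^k$.
   Context: $C_n := \frac{(2n)!}{(n+1)!\,n!}$ denotes the $n$-th Catalan number. -}

module Defs where

open import Data.Nat using (ℕ; suc; _+_; _*_; _^_; _/_; _!; NonZero)
open import Data.Nat.Properties using (_!≢0; m*n≢0)

catalan : ℕ → ℕ
catalan n = ((2 * n) !) / ((suc n) ! * n !)
  where
  instance
    nz : NonZero ((suc n) ! * n !)
    nz = m*n≢0 ((suc n) !) (n !) {{(suc n) !≢0}} {{n !≢0}}

open import Data.Nat using (_%_)
open import Data.Nat.Properties using (m^n≢0)

_mod2^_ : ℕ → ℕ → ℕ
x mod2^ k = _%_ x (2 ^ k) {{m^n≢0 2 k}}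

{-# OPTIONS --safe #-}
-- Put A m = C_(2^m − 1) and N = 2^m. From C_n (n + 1)! = 2^n (2n − 1)!! one gets the exact relation
--   A (m + 1) · (2N − 1)!! · (4N − 1) = A m · (2N − 1) · (2N + 1)(2N + 3) ⋯ (4N − 1).
-- For even N the shifted odd product on the right is ≡ (2N − 1)!! modulo 4N, so cancelling that odd
-- number gives A (m + 1) ≡ A m + 2N (mod 4N) for m ≥ 1, and with it that every A m is odd.
-- Telescoping, A j − A i ≡ 2^(i + 1) (mod 2^(i + 2)) for 1 ≤ i < j, so 2^k with k > j cannot divide A j − A i.
module Submission where

open import Defs

module OddProducts where

  open import Data.Nat using (ℕ; zero; suc; _+_; _*_; _∸_; _^_; _!)
  open import Data.Nat.Properties
    using (+-identityʳ; *-identityʳ; *-assoc; +-suc; m+n∸m≡n; m≤m+n; *-distribʳ-∸; m+n∸n≡m; *-cancelʳ-≡; ^-distribˡ-+-*; _!≢0; m*n≢0; m^n≢0)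
  open import Data.Nat.Divisibility using (_∣_; divides)
  open import Data.Nat.DivMod using (m/n*n≡m)
  open import Data.Nat.Combinatorics using (k![n∸k]!∣n!)
  open import Data.Nat.Tactic.RingSolver using (solve-∀)
  open import Data.Product using (∃; _,_)
  open import Relation.Binary.PropositionalEquality using (_≡_; refl; sym; trans; cong; cong₂; subst; module ≡-Reasoning)
  open ≡-Reasoning

  oddProductFrom : ℕ → ℕ → ℕ
  oddProductFrom a zero    = 1
  oddProductFrom a (suc n) = (1 + 2 * (a + n)) * oddProductFrom a n

  oddProduct : ℕ → ℕ
  oddProduct = oddProductFrom 0

  oddProductFrom-+ : ∀ a m n → oddProductFrom a (m + n) ≡ oddProductFrom a m * oddProductFrom (a + m) n
  oddProductFrom-+ a m zero = trans (cong (oddProductFrom a) (+-identityʳ m)) (sym (*-identityʳ _))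
  oddProductFrom-+ a m (suc n) = begin
    oddProductFrom a (m + suc n)                                ≡⟨ cong (oddProductFrom a) (+-suc m n) ⟩
    (1 + 2 * (a + (m + n))) * oddProductFrom a (m + n)          ≡⟨ cong ((1 + 2 * (a + (m + n))) *_) (oddProductFrom-+ a m n) ⟩
    (1 + 2 * (a + (m + n))) * (oddProductFrom a m * oddProductFrom (a + m) n)
      ≡⟨ reassociate a m n (oddProductFrom a m) (oddProductFrom (a + m) n) ⟩
    oddProductFrom a m * ((1 + 2 * (a + m + n)) * oddProductFrom (a + m) n) ∎
    where
    reassociate : ∀ a m n x y → (1 + 2 * (a + (m + n))) * (x * y) ≡ x * ((1 + 2 * (a + m + n)) * y)
    reassociate = solve-∀

  oddProductFrom-odd : ∀ a n → ∃ λ v → oddProductFrom a n ≡ 1 + 2 * v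
  oddProductFrom-odd a zero = 0 , refl
  oddProductFrom-odd a (suc n) with oddProductFrom-odd a n
  ... | v , eq = a + n + v + 2 * (a + n) * v , trans (cong ((1 + 2 * (a + n)) *_) eq) (odd*odd (a + n) v)
    where
    odd*odd : ∀ k v → (1 + 2 * k) * (1 + 2 * v) ≡ 1 + 2 * (k + v + 2 * k * v)
    odd*odd = solve-∀

  -- Shifting every factor by 2t changes the product by 2t per factor, modulo 4t.
  oddProductFrom≡oddProduct+2tn : ∀ t n → ∃ λ r → oddProductFrom t n ≡ oddProduct n + 2 * t * n + 4 * t * r
  oddProductFrom≡oddProduct+2tn t zero = 0 , base t
    where
    base : ∀ t → 1 ≡ 1 + 2 * t * 0 + 4 * t * 0
    base = solve-∀
  oddProductFrom≡oddProduct+2tn t (suc n)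
    with oddProductFrom≡oddProduct+2tn t n | oddProductFrom-odd 0 n
  ... | r , eqr | v , eqv = r′ , (begin
    (1 + 2 * (t + n)) * oddProductFrom t n                       ≡⟨ cong ((1 + 2 * (t + n)) *_) eqr ⟩
    (1 + 2 * (t + n)) * (oddProduct n + 2 * t * n + 4 * t * r)  ≡⟨ subst Step (sym eqv) (step t n v r) ⟩
    (1 + 2 * n) * oddProduct n + 2 * t * suc n + 4 * t * r′      ∎)
    where
    r′ = v + n * n + t * n + r * (1 + 2 * t + 2 * n)
    Step : ℕ → Set
    Step o = (1 + 2 * (t + n)) * (o + 2 * t * n + 4 * t * r) ≡ (1 + 2 * n) * o + 2 * t * suc n + 4 * t * r′
    step : ∀ t n v r → (1 + 2 * (t + n)) * (1 + 2 * v + 2 * t * n + 4 * t * r)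
                     ≡ (1 + 2 * n) * (1 + 2 * v) + 2 * t * suc n + 4 * t * (v + n * n + t * n + r * (1 + 2 * t + 2 * n))
    step = solve-∀

  [2n]!≡2^n*n!*oddProduct[n] : ∀ n → (2 * n) ! ≡ 2 ^ n * n ! * oddProduct n
  [2n]!≡2^n*n!*oddProduct[n] zero = refl
  [2n]!≡2^n*n!*oddProduct[n] (suc n) = begin
    (2 * suc n) !                                      ≡⟨ cong _! (2[1+n]≡2+2n n) ⟩
    (2 + 2 * n) * ((1 + 2 * n) * (2 * n) !)            ≡⟨ cong (λ f → (2 + 2 * n) * ((1 + 2 * n) * f)) ([2n]!≡2^n*n!*oddProduct[n] n) ⟩
    (2 + 2 * n) * ((1 + 2 * n) * (2 ^ n * n ! * oddProduct n)) ≡⟨ regroup n (2 ^ n) (n !) (oddProduct n) ⟩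
    2 ^ suc n * suc n ! * oddProduct (suc n)           ∎
    where
    2[1+n]≡2+2n : ∀ n → 2 * suc n ≡ 2 + 2 * n
    2[1+n]≡2+2n = solve-∀
    regroup : ∀ n p f o → (2 + 2 * n) * ((1 + 2 * n) * (p * f * o)) ≡ 2 * p * (f + n * f) * ((1 + 2 * n) * o)
    regroup = solve-∀

  k!*m!∣[k+m]! : ∀ k m → k ! * m ! ∣ (k + m) !
  k!*m!∣[k+m]! k m = subst (λ j → k ! * j ! ∣ (k + m) !) (m+n∸m≡n k m) (k![n∸k]!∣n! (m≤m+n k m))

  -- C(2n, n) − C(2n, n + 1) = C_n, realised on the cofactors of n! n! and (n + 1)! (n − 1)! in (2n)!.
  [1+n]!*n!∣[2n]! : ∀ n → suc n ! * n ! ∣ (2 * n) !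
  [1+n]!*n!∣[2n]! zero = divides 1 refl
  [1+n]!*n!∣[2n]! n@(suc p) = divides (b₁ ∸ b₂) (sym (begin
    (b₁ ∸ b₂) * (suc n ! * n !)                  ≡⟨ *-distribʳ-∸ (suc n ! * n !) b₁ b₂ ⟩
    b₁ * (suc n ! * n !) ∸ b₂ * (suc n ! * n !)  ≡⟨ cong₂ _∸_ cofactor₁ cofactor₂ ⟩
    F + n * F ∸ n * F                            ≡⟨ m+n∸n≡m F (n * F) ⟩
    F                                            ∎))
    where
    F = (2 * n) !
    n!n!∣F : n ! * n ! ∣ F
    n!n!∣F = subst (λ m → n ! * n ! ∣ (n + m) !) (sym (+-identityʳ n)) (k!*m!∣[k+m]! n n)
    [1+n]!p!∣F : suc n ! * p ! ∣ F
    [1+n]!p!∣F = subst (λ m → suc n ! * p ! ∣ m !) (sym (2[1+p]≡[2+p]+p p)) (k!*m!∣[k+m]! (suc n) p)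
      where
      2[1+p]≡[2+p]+p : ∀ p → 2 * suc p ≡ suc (suc p) + p
      2[1+p]≡[2+p]+p = solve-∀
    b₁ = _∣_.quotient n!n!∣F
    b₂ = _∣_.quotient [1+n]!p!∣F
    cofactor₁ : b₁ * (suc n ! * n !) ≡ F + n * F
    cofactor₁ = trans (regroup b₁ n (n !)) (cong (suc n *_) (sym (_∣_.equality n!n!∣F)))
      where
      regroup : ∀ b n f → b * (suc n * f * f) ≡ suc n * (b * (f * f))
      regroup = solve-∀
    cofactor₂ : b₂ * (suc n ! * n !) ≡ n * F
    cofactor₂ = trans (regroup b₂ n (suc n !) (p !)) (cong (n *_) (sym (_∣_.equality [1+n]!p!∣F)))
      where
      regroup : ∀ b n g f → b * (g * (n * f)) ≡ n * (b * (g * f))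
      regroup = solve-∀

  catalan*[1+n]!*n!≡[2n]! : ∀ n → catalan n * (suc n ! * n !) ≡ (2 * n) !
  catalan*[1+n]!*n!≡[2n]! n = m/n*n≡m {{m*n≢0 (suc n !) (n !) {{suc n !≢0}} {{n !≢0}}}} ([1+n]!*n!∣[2n]! n)

  catalan*[1+n]!≡2^n*oddProduct[n] : ∀ n → catalan n * suc n ! ≡ 2 ^ n * oddProduct n
  catalan*[1+n]!≡2^n*oddProduct[n] n = *-cancelʳ-≡ _ _ (n !) {{n !≢0}} (begin
    catalan n * suc n ! * n !    ≡⟨ *-assoc (catalan n) (suc n !) (n !) ⟩
    catalan n * (suc n ! * n !)  ≡⟨ catalan*[1+n]!*n!≡[2n]! n ⟩
    (2 * n) !                    ≡⟨ [2n]!≡2^n*n!*oddProduct[n] n ⟩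
    2 ^ n * n ! * oddProduct n   ≡⟨ regroup (2 ^ n) (n !) (oddProduct n) ⟩
    2 ^ n * oddProduct n * n !   ∎)
    where
    regroup : ∀ a f o → a * f * o ≡ a * o * f
    regroup = solve-∀

  catalan-doubling : ∀ p → let N = suc p; q = p + N in
    catalan q * oddProduct N * (1 + 2 * q) ≡ catalan p * (1 + 2 * p) * oddProductFrom N N
  catalan-doubling p = *-cancelʳ-≡ _ _ (2 ^ N * N !) {{m*n≢0 (2 ^ N) (N !) {{m^n≢0 2 N}} {{N !≢0}}}}
    (trans lhs-scaled (sym rhs-scaled))
    where
    N = suc p
    q = p + N
    P = oddProductFrom N N
    lhs-scaled : catalan q * oddProduct N * (1 + 2 * q) * (2 ^ N * N !) ≡ 2 ^ p * 2 ^ N * (oddProduct N * P)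
    lhs-scaled = begin
      catalan q * oddProduct N * (1 + 2 * q) * (2 ^ N * N !)  ≡⟨ regroup (catalan q) (oddProduct N) (1 + 2 * q) (2 ^ N) (N !) ⟩
      catalan q * (2 ^ N * N ! * oddProduct N) * (1 + 2 * q)  ≡⟨ cong (λ f → catalan q * f * (1 + 2 * q)) (sym ([2n]!≡2^n*n!*oddProduct[n] N)) ⟩
      catalan q * (2 * N) ! * (1 + 2 * q)                      ≡⟨ cong (λ m → catalan q * (N + m) ! * (1 + 2 * q)) (+-identityʳ N) ⟩
      catalan q * suc q ! * (1 + 2 * q)                        ≡⟨ cong (_* (1 + 2 * q)) (catalan*[1+n]!≡2^n*oddProduct[n] q) ⟩
      2 ^ q * oddProduct q * (1 + 2 * q)                       ≡⟨ regroup′ (2 ^ q) (oddProduct q) (1 + 2 * q) ⟩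
      2 ^ q * oddProduct (suc q)                               ≡⟨ cong₂ _*_ (^-distribˡ-+-* 2 p N) (oddProductFrom-+ 0 N N) ⟩
      2 ^ p * 2 ^ N * (oddProduct N * P)                       ∎
      where
      regroup : ∀ c o s a f → c * o * s * (a * f) ≡ c * (a * f * o) * s
      regroup = solve-∀
      regroup′ : ∀ a o s → a * o * s ≡ a * (s * o)
      regroup′ = solve-∀
    rhs-scaled : catalan p * (1 + 2 * p) * P * (2 ^ N * N !) ≡ 2 ^ p * 2 ^ N * (oddProduct N * P)
    rhs-scaled = begin
      catalan p * (1 + 2 * p) * P * (2 ^ N * N !)   ≡⟨ regroup (catalan p) (1 + 2 * p) P (2 ^ N) (N !) ⟩
      2 ^ N * (catalan p * N !) * (1 + 2 * p) * P   ≡⟨ cong (λ x → 2 ^ N * x * (1 + 2 * p) * P) (catalan*[1+n]!≡2^n*oddProduct[n] p) ⟩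
      2 ^ N * (2 ^ p * oddProduct p) * (1 + 2 * p) * P  ≡⟨ regroup′ (2 ^ N) (2 ^ p) (oddProduct p) (1 + 2 * p) P ⟩
      2 ^ p * 2 ^ N * (oddProduct N * P)             ∎
      where
      regroup : ∀ c s x a f → c * s * x * (a * f) ≡ a * (c * f) * s * x
      regroup = solve-∀
      regroup′ : ∀ a b o s x → a * (b * o) * s * x ≡ b * a * (s * o * x)
      regroup′ = solve-∀

module TwoAdic where

  open import Data.Integer using (ℤ; +_; _+_; _*_; _-_; _^_; 1ℤ)
  open import Data.Integer.Properties using (pos-*; *-identityʳ; *-comm; ^-distribˡ-+-*)
  open import Data.Integer.Divisibility.Signed
    using (_∣_; divides; ∣-refl; ∣-trans; quotient; ∣⇒∣ᵤ; ∣m∣n⇒∣m+n; ∣m∣n⇒∣m-n; ∣n⇒∣m*n; ∣m⇒∣m*n; *-monoʳ-∣; *-cancelˡ-∣)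
  open import Data.Integer.Tactic.RingSolver using (solve-∀)
  import Data.Nat as ℕ
  import Data.Nat.Properties as ℕ
  import Data.Nat.Divisibility as ℕ
  open import Data.Integer.DivMod using (a≡a%ℕn+[a/ℕn]*n)
  open import Data.Product using (_,_)
  open import Data.Sum using (inj₁; inj₂)
  open import Relation.Binary.PropositionalEquality using (_≡_; refl; sym; trans; cong; cong₂; subst; subst₂; module ≡-Reasoning)
  open import Relation.Nullary using (¬_)
  open ≡-Reasoning

  2ℤ : ℤ
  2ℤ = + 2

  Odd : ℤ → Set
  Odd x = 2ℤ ∣ x - 1ℤ

  pos-^ : ∀ m n → + (m ℕ.^ n) ≡ (+ m) ^ n
  pos-^ m ℕ.zero    = refl
  pos-^ m (ℕ.suc n) = trans (pos-* m (m ℕ.^ n)) (cong (+ m *_) (pos-^ m n))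

  ^-monoʳ-∣ : ∀ x {m n} → m ℕ.≤ n → x ^ m ∣ x ^ n
  ^-monoʳ-∣ x {m} m≤n with ℕ.m≤n⇒∃[o]m+o≡n m≤n
  ... | o , refl = divides (x ^ o) (trans (^-distribˡ-+-* x m o) (*-comm (x ^ m) (x ^ o)))

  2^[1+e]∤2^e : ∀ e → ¬ (2ℤ ^ ℕ.suc e ∣ 2ℤ ^ e)
  2^[1+e]∤2^e e 2^[1+e]∣2^e = ℕ.>⇒∤ {{ℕ.m^n≢0 2 e}} (ℕ.^-monoʳ-< 2 (ℕ.s≤s (ℕ.s≤s ℕ.z≤n)) (ℕ.n<1+n e))
    (∣⇒∣ᵤ (subst₂ _∣_ (sym (pos-^ 2 (ℕ.suc e))) (sym (pos-^ 2 e)) 2^[1+e]∣2^e))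

  2∣2^[1+e] : ∀ e → 2ℤ ∣ 2ℤ ^ ℕ.suc e
  2∣2^[1+e] e = divides (2ℤ ^ e) (*-comm 2ℤ (2ℤ ^ e))

  ∣-cancel-odd : ∀ e {o x} → Odd o → 2ℤ ^ e ∣ o * x → 2ℤ ^ e ∣ x
  ∣-cancel-odd ℕ.zero    {x = x} _ _ = divides x (sym (*-identityʳ x))
  ∣-cancel-odd (ℕ.suc e) {o} {x} o-odd 2^[1+e]∣ox with 2∣x
    where
    2∣x : 2ℤ ∣ x
    2∣x = subst (2ℤ ∣_) (x≡ox-[o-1]x o x)
            (∣m∣n⇒∣m-n (∣-trans (2∣2^[1+e] e) 2^[1+e]∣ox) (∣m⇒∣m*n x o-odd))
      where
      x≡ox-[o-1]x : ∀ o x → o * x - (o - 1ℤ) * x ≡ x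
      x≡ox-[o-1]x = solve-∀
  ... | divides y refl = subst (2ℤ ^ ℕ.suc e ∣_) (*-comm 2ℤ y) (*-monoʳ-∣ 2ℤ 2^e∣y)
    where
    2^e∣y : 2ℤ ^ e ∣ y
    2^e∣y = ∣-cancel-odd e {o} o-odd (*-cancelˡ-∣ 2ℤ (subst (2ℤ ^ ℕ.suc e ∣_) (regroup o y) 2^[1+e]∣ox))
      where
      regroup : ∀ o y → o * (y * 2ℤ) ≡ 2ℤ * (o * y)
      regroup = solve-∀

  %≡%⇒∣- : ∀ x y d .{{_ : ℕ.NonZero d}} → x ℕ.% d ≡ y ℕ.% d → + d ∣ + x - + y
  %≡%⇒∣- x y d x%d≡y%d = divides (qx - qy) (begin
    + x - + y                        ≡⟨ cong₂ _-_ (a≡a%ℕn+[a/ℕn]*n (+ x) d) (a≡a%ℕn+[a/ℕn]*n (+ y) d) ⟩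
    (+ (x ℕ.% d) + qx * D) - (r + qy * D)  ≡⟨ cong (λ z → (+ z + qx * D) - (r + qy * D)) x%d≡y%d ⟩
    (r + qx * D) - (r + qy * D)      ≡⟨ cancel r qx qy D ⟩
    (qx - qy) * D                    ∎)
    where
    D = + d
    r = + (y ℕ.% d)
    qx = + (x ℕ./ d)
    qy = + (y ℕ./ d)
    cancel : ∀ r a b d → (r + a * d) - (r + b * d) ≡ (a - b) * d
    cancel = solve-∀

  2-adic-telescope : (f : ℕ.ℕ → ℤ) {i : ℕ.ℕ} →
                     (∀ {j} → i ℕ.≤ j → 2ℤ ^ (2 ℕ.+ j) ∣ f (ℕ.suc j) - f j - 2ℤ ^ (1 ℕ.+ j)) →
                     ∀ {j} → i ℕ.< j → 2ℤ ^ (2 ℕ.+ i) ∣ f j - f i - 2ℤ ^ (1 ℕ.+ i)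
  2-adic-telescope f {i} step {ℕ.suc j} i<1+j with ℕ.m<1+n⇒m<n∨m≡n i<1+j
  ... | inj₂ refl = step ℕ.≤-refl
  ... | inj₁ i<j  = subst (2ℤ ^ (2 ℕ.+ i) ∣_) (split (f (ℕ.suc j)) (f j) (f i) (2ℤ ^ (1 ℕ.+ j)) (2ℤ ^ (1 ℕ.+ i)))
    (∣m∣n⇒∣m+n (∣m∣n⇒∣m+n (∣-trans (^-monoʳ-∣ 2ℤ (ℕ.s≤s (ℕ.s≤s (ℕ.<⇒≤ i<j)))) (step (ℕ.<⇒≤ i<j)))
                           (^-monoʳ-∣ 2ℤ (ℕ.s≤s i<j)))
               (2-adic-telescope f step i<j))
    where
    split : ∀ a b c p q → (a - b - p) + p + (b - c - q) ≡ a - c - q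
    split = solve-∀

  -- Modulo 2h the hypothesis reads −a·o ≡ b·(h − 1)·o; cancelling the odd o and using h·b ≡ h gives a ≡ b + h.
  ≡+2^e-mod-2^[1+e] : ∀ e {a b o P} → a * o * (2ℤ ^ ℕ.suc e - 1ℤ) ≡ b * (2ℤ ^ e - 1ℤ) * P →
                  2ℤ ^ ℕ.suc e ∣ P - o → Odd o → Odd b → 2ℤ ^ ℕ.suc e ∣ a - b - 2ℤ ^ e
  ≡+2^e-mod-2^[1+e] e {a} {b} {o} {P} eq M∣P-o o-odd b-odd =
    subst (M ∣_) (regroup a b h) (∣m∣n⇒∣m-n (∣m∣n⇒∣m-n M∣a+b[h-1] M∣h[b-1]) ∣-refl)
    where
    h = 2ℤ ^ e
    M = 2ℤ ^ ℕ.suc e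
    regroup : ∀ a b h → (a + b * (h - 1ℤ)) - h * (b - 1ℤ) - 2ℤ * h ≡ a - b - h
    regroup = solve-∀
    o[a+b[h-1]]≡ : o * (a + b * (h - 1ℤ)) ≡ a * o * M - b * (h - 1ℤ) * (P - o)
    o[a+b[h-1]]≡ = begin
      o * (a + b * (h - 1ℤ))                               ≡⟨ expand a b o h ⟩
      a * o * M - a * o * (M - 1ℤ) + b * (h - 1ℤ) * o       ≡⟨ cong (λ z → a * o * M - z + b * (h - 1ℤ) * o) eq ⟩
      a * o * M - b * (h - 1ℤ) * P + b * (h - 1ℤ) * o       ≡⟨ collect a b o h P ⟩
      a * o * M - b * (h - 1ℤ) * (P - o)                   ∎
      where
      expand : ∀ a b o h → o * (a + b * (h - 1ℤ)) ≡ a * o * (2ℤ * h) - a * o * (2ℤ * h - 1ℤ) + b * (h - 1ℤ) * o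
      expand = solve-∀
      collect : ∀ a b o h P → a * o * (2ℤ * h) - b * (h - 1ℤ) * P + b * (h - 1ℤ) * o ≡ a * o * (2ℤ * h) - b * (h - 1ℤ) * (P - o)
      collect = solve-∀
    M∣a+b[h-1] : M ∣ a + b * (h - 1ℤ)
    M∣a+b[h-1] = ∣-cancel-odd (ℕ.suc e) {o} o-odd (subst (M ∣_) (sym o[a+b[h-1]]≡)
      (∣m∣n⇒∣m-n (∣n⇒∣m*n (a * o) ∣-refl) (∣n⇒∣m*n (b * (h - 1ℤ)) M∣P-o)))
    M∣h[b-1] : M ∣ h * (b - 1ℤ)
    M∣h[b-1] = divides (quotient b-odd) (trans (cong (h *_) (_∣_.equality b-odd)) (regroup′ h (quotient b-odd)))
      where
      regroup′ : ∀ h u → h * (u * 2ℤ) ≡ u * (2ℤ * h)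
      regroup′ = solve-∀

module CatalanAtMersenneIndices where

  open OddProducts
  open TwoAdic
  open import Data.Integer using (ℤ; +_; _+_; _*_; _-_; _^_; 1ℤ; 0ℤ)
  open import Data.Integer.Properties using (pos-+; pos-*)
  open import Data.Integer.Divisibility.Signed using (_∣_; divides; ∣-trans; ∣m∣n⇒∣m+n; ∣m∣n⇒∣m-n)
  open import Data.Integer.Tactic.RingSolver using (solve-∀)
  import Data.Nat as ℕ
  import Data.Nat.Properties as ℕ
  import Data.Nat.Tactic.RingSolver as ℕ-Ring
  open import Data.Product using (∃; _,_)
  open import Relation.Binary.PropositionalEquality using (_≡_; refl; sym; trans; cong; subst; module ≡-Reasoning)
  open import Relation.Nullary using (¬_)
  open ≡-Reasoning

  pos-[2^e-1] : ∀ {k} e → ℕ.suc k ≡ 2 ℕ.^ e → + k ≡ 2ℤ ^ e - 1ℤ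
  pos-[2^e-1] {k} e [1+k]≡2^e = begin
    + k                   ≡⟨ k≡[1+k]-1 (+ k) ⟩
    1ℤ + + k - 1ℤ         ≡⟨ cong (λ x → x - 1ℤ) (sym (pos-+ 1 k)) ⟩
    + ℕ.suc k - 1ℤ        ≡⟨ cong (λ x → + x - 1ℤ) [1+k]≡2^e ⟩
    + (2 ℕ.^ e) - 1ℤ      ≡⟨ cong (_- 1ℤ) (pos-^ 2 e) ⟩
    2ℤ ^ e - 1ℤ           ∎
    where
    k≡[1+k]-1 : ∀ k → k ≡ 1ℤ + k - 1ℤ
    k≡[1+k]-1 = solve-∀

  odd-pos : ∀ {x} → ∃ (λ v → x ≡ 1 ℕ.+ 2 ℕ.* v) → Odd (+ x)
  odd-pos (v , refl) = divides (+ v) (begin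
    + (1 ℕ.+ 2 ℕ.* v) - 1ℤ     ≡⟨ cong (_- 1ℤ) (trans (pos-+ 1 (2 ℕ.* v)) (cong (λ y → 1ℤ + y) (pos-* 2 v))) ⟩
    1ℤ + 2ℤ * + v - 1ℤ        ≡⟨ cancel (+ v) ⟩
    + v * 2ℤ                  ∎)
    where
    cancel : ∀ v → 1ℤ + 2ℤ * v - 1ℤ ≡ v * 2ℤ
    cancel = solve-∀

  pos-*³ : ∀ a b c → + (a ℕ.* b ℕ.* c) ≡ + a * + b * + c
  pos-*³ a b c = trans (pos-* (a ℕ.* b) c) (cong (_* + c) (pos-* a b))

  catalan-doubling-ℤ : ∀ p e → ℕ.suc p ≡ 2 ℕ.^ ℕ.suc e →
    + catalan (p ℕ.+ ℕ.suc p) * + oddProduct (ℕ.suc p) * (2ℤ ^ (3 ℕ.+ e) - 1ℤ)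
      ≡ + catalan p * (2ℤ ^ (2 ℕ.+ e) - 1ℤ) * + oddProductFrom (ℕ.suc p) (ℕ.suc p)
  catalan-doubling-ℤ p e [1+p]≡2^[1+e] = begin
    + c₁ * + o * (2ℤ ^ (3 ℕ.+ e) - 1ℤ)  ≡⟨ cong (λ x → + c₁ * + o * x) (sym (pos-[2^e-1] (3 ℕ.+ e) [2+2q]≡2^[3+e])) ⟩
    + c₁ * + o * + (1 ℕ.+ 2 ℕ.* q)       ≡⟨ sym (pos-*³ c₁ o (1 ℕ.+ 2 ℕ.* q)) ⟩
    + (c₁ ℕ.* o ℕ.* (1 ℕ.+ 2 ℕ.* q))     ≡⟨ cong +_ (catalan-doubling p) ⟩
    + (c₀ ℕ.* (1 ℕ.+ 2 ℕ.* p) ℕ.* P)     ≡⟨ pos-*³ c₀ (1 ℕ.+ 2 ℕ.* p) P ⟩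
    + c₀ * + (1 ℕ.+ 2 ℕ.* p) * + P       ≡⟨ cong (λ x → + c₀ * x * + P) (pos-[2^e-1] (2 ℕ.+ e) [2+2p]≡2^[2+e]) ⟩
    + c₀ * (2ℤ ^ (2 ℕ.+ e) - 1ℤ) * + P   ∎
    where
    q = p ℕ.+ ℕ.suc p
    c₁ = catalan q
    c₀ = catalan p
    o = oddProduct (ℕ.suc p)
    P = oddProductFrom (ℕ.suc p) (ℕ.suc p)
    [2+2q]≡2^[3+e] : ℕ.suc (1 ℕ.+ 2 ℕ.* q) ≡ 2 ℕ.^ (3 ℕ.+ e)
    [2+2q]≡2^[3+e] = trans (expand₁ p) (cong (λ x → 2 ℕ.* (2 ℕ.* x)) [1+p]≡2^[1+e])
      where
      expand₁ : ∀ p → ℕ.suc (1 ℕ.+ 2 ℕ.* (p ℕ.+ ℕ.suc p)) ≡ 2 ℕ.* (2 ℕ.* ℕ.suc p)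
      expand₁ = ℕ-Ring.solve-∀
    [2+2p]≡2^[2+e] : ℕ.suc (1 ℕ.+ 2 ℕ.* p) ≡ 2 ℕ.^ (2 ℕ.+ e)
    [2+2p]≡2^[2+e] = trans (expand₀ p) (cong (2 ℕ.*_) [1+p]≡2^[1+e])
      where
      expand₀ : ∀ p → ℕ.suc (1 ℕ.+ 2 ℕ.* p) ≡ 2 ℕ.* ℕ.suc p
      expand₀ = ℕ-Ring.solve-∀

  oddProductFrom≡oddProduct-mod : ∀ e → let t = 2 ℕ.^ ℕ.suc e in
    2ℤ ^ (3 ℕ.+ e) ∣ + oddProductFrom t t - + oddProduct t
  oddProductFrom≡oddProduct-mod e with oddProductFrom≡oddProduct+2tn (2 ℕ.^ ℕ.suc e) (2 ℕ.^ ℕ.suc e)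
  ... | r , P≡ = divides (+ s) (begin
    + oddProductFrom t t - + O         ≡⟨ cong (λ x → + x - + O) (trans P≡ (regroup O (2 ℕ.^ e) r)) ⟩
    + (O ℕ.+ s ℕ.* 2 ℕ.^ (3 ℕ.+ e)) - + O  ≡⟨ cong (_- + O) (trans (pos-+ O _) (cong (λ y → + O + y) (pos-* s _))) ⟩
    + O + + s * + (2 ℕ.^ (3 ℕ.+ e)) - + O  ≡⟨ cancel (+ O) (+ s) _ ⟩
    + s * + (2 ℕ.^ (3 ℕ.+ e))              ≡⟨ cong (+ s *_) (pos-^ 2 (3 ℕ.+ e)) ⟩
    + s * 2ℤ ^ (3 ℕ.+ e)                  ∎)
    where
    t = 2 ℕ.^ ℕ.suc e
    O = oddProduct t
    s = 2 ℕ.^ e ℕ.+ r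
    regroup : ∀ o x r → o ℕ.+ 2 ℕ.* (2 ℕ.* x) ℕ.* (2 ℕ.* x) ℕ.+ 4 ℕ.* (2 ℕ.* x) ℕ.* r
                      ≡ o ℕ.+ (x ℕ.+ r) ℕ.* (2 ℕ.* (2 ℕ.* (2 ℕ.* x)))
    regroup = ℕ-Ring.solve-∀
    cancel : ∀ o s m → o + s * m - o ≡ s * m
    cancel = solve-∀

  catalan-doubling-≡-mod : ∀ p e → ℕ.suc p ≡ 2 ℕ.^ ℕ.suc e → Odd (+ catalan p) →
    2ℤ ^ (3 ℕ.+ e) ∣ + catalan (p ℕ.+ ℕ.suc p) - + catalan p - 2ℤ ^ (2 ℕ.+ e)
  catalan-doubling-≡-mod p e [1+p]≡2^[1+e] cp-odd = ≡+2^e-mod-2^[1+e] (2 ℕ.+ e) {+ catalan (p ℕ.+ t)} {+ catalan p} {+ oddProduct t} {+ oddProductFrom t t}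
    (catalan-doubling-ℤ p e [1+p]≡2^[1+e])
    (subst (λ t → 2ℤ ^ (3 ℕ.+ e) ∣ + oddProductFrom t t - + oddProduct t) (sym [1+p]≡2^[1+e])
           (oddProductFrom≡oddProduct-mod e))
    (odd-pos (oddProductFrom-odd 0 t)) cp-odd
    where
    t = ℕ.suc p

  catalanMersenne : ℕ.ℕ → ℤ
  catalanMersenne m = + catalan (2 ℕ.^ m ℕ.∸ 1)

  2n∸1≡pred[n]+n : ∀ n .{{_ : ℕ.NonZero n}} → 2 ℕ.* n ℕ.∸ 1 ≡ ℕ.pred n ℕ.+ ℕ.suc (ℕ.pred n)
  2n∸1≡pred[n]+n (ℕ.suc p) = cong (p ℕ.+_) (ℕ.+-identityʳ (ℕ.suc p))

  odd⇒catalanMersenne-step : ∀ e → Odd (catalanMersenne (1 ℕ.+ e)) →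
    2ℤ ^ (3 ℕ.+ e) ∣ catalanMersenne (2 ℕ.+ e) - catalanMersenne (1 ℕ.+ e) - 2ℤ ^ (2 ℕ.+ e)
  odd⇒catalanMersenne-step e odd =
    subst (λ m → 2ℤ ^ (3 ℕ.+ e) ∣ + catalan m - catalanMersenne (1 ℕ.+ e) - 2ℤ ^ (2 ℕ.+ e))
          (sym (2n∸1≡pred[n]+n N))
          (catalan-doubling-≡-mod (ℕ.pred N) e (ℕ.suc-pred N) odd)
    where
    N = 2 ℕ.^ ℕ.suc e
    instance
      _ : ℕ.NonZero N
      _ = ℕ.m^n≢0 2 (ℕ.suc e)

  catalanMersenne-odd : ∀ e → Odd (catalanMersenne (1 ℕ.+ e))
  catalanMersenne-odd ℕ.zero    = divides 0ℤ refl
  catalanMersenne-odd (ℕ.suc e) =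
    subst (2ℤ ∣_) (split (catalanMersenne (2 ℕ.+ e)) (catalanMersenne (1 ℕ.+ e)) (2ℤ ^ (2 ℕ.+ e)))
    (∣m∣n⇒∣m+n (∣m∣n⇒∣m+n (∣-trans (2∣2^[1+e] (2 ℕ.+ e)) (odd⇒catalanMersenne-step e odd)) (2∣2^[1+e] (1 ℕ.+ e))) odd)
    where
    odd = catalanMersenne-odd e
    split : ∀ a b h → (a - b - h) + h + (b - 1ℤ) ≡ a - 1ℤ
    split = solve-∀

  catalanMersenne-step : ∀ {j} → 1 ℕ.≤ j →
    2ℤ ^ (2 ℕ.+ j) ∣ catalanMersenne (ℕ.suc j) - catalanMersenne j - 2ℤ ^ (1 ℕ.+ j)
  catalanMersenne-step {ℕ.suc e} _ = odd⇒catalanMersenne-step e (catalanMersenne-odd e)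

  catalan-2^i∸1≢catalan-2^j∸1-mod2^k : ∀ {i j k} → 1 ℕ.≤ i → i ℕ.< j → j ℕ.< k →
    ¬ (catalan (2 ℕ.^ i ℕ.∸ 1) mod2^ k ≡ catalan (2 ℕ.^ j ℕ.∸ 1) mod2^ k)
  catalan-2^i∸1≢catalan-2^j∸1-mod2^k {i} {j} {k} 1≤i i<j j<k ≡-mod2^k =
    2^[1+e]∤2^e (1 ℕ.+ i) (subst (2ℤ ^ (2 ℕ.+ i) ∣_) (difference (catalanMersenne j) (catalanMersenne i) (2ℤ ^ (1 ℕ.+ i)))
      (∣m∣n⇒∣m-n (∣-trans (^-monoʳ-∣ 2ℤ (ℕ.≤-trans (ℕ.s≤s i<j) j<k)) 2^k∣Aj-Ai)
                 (2-adic-telescope catalanMersenne (λ i≤j → catalanMersenne-step (ℕ.≤-trans 1≤i i≤j)) i<j)))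
    where
    2^k∣Aj-Ai : 2ℤ ^ k ∣ catalanMersenne j - catalanMersenne i
    2^k∣Aj-Ai = subst (_∣ catalanMersenne j - catalanMersenne i) (pos-^ 2 k)
                  (%≡%⇒∣- _ _ (2 ℕ.^ k) {{ℕ.m^n≢0 2 k}} (sym ≡-mod2^k))
    difference : ∀ a b h → (a - b) - (a - b - h) ≡ h
    difference = solve-∀

open import Data.Nat using (ℕ; _≤_; _<_; _∸_; _^_)
open import Data.Nat.Properties using (<-cmp)
open import Relation.Binary.Definitions using (tri<; tri≈; tri>)
open import Relation.Binary.PropositionalEquality using (_≡_; sym)
open import Relation.Nullary using (¬_)
open CatalanAtMersenneIndices using (catalan-2^i∸1≢catalan-2^j∸1-mod2^k)

corollary3p3 : (k : ℕ) → 2 ≤ k → (i j : ℕ) → 1 ≤ i → i < k → 1 ≤ j → j < k → ¬ (i ≡ j) →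
    ¬ (catalan (2 ^ i ∸ 1) mod2^ k ≡ catalan (2 ^ j ∸ 1) mod2^ k)
corollary3p3 k _ i j 1≤i i<k 1≤j j<k i≢j with <-cmp i j
... | tri< i<j _ _ = catalan-2^i∸1≢catalan-2^j∸1-mod2^k 1≤i i<j j<k
... | tri≈ _ i≡j _ = λ _ → i≢j i≡j
... | tri> _ _ j<i = λ ≡-mod2^k → catalan-2^i∸1≢catalan-2^j∸1-mod2^k 1≤j j<i i<k (sym ≡-mod2^k)
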